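{- Let $d>0$ and $N\geq d$ be integers, and for integers $n\geq 1$ let $f(n)=1+\dfrac{d-\operatorname{rem}(n,d)}{n}$. Then, over $n\in\{1,2,\ldots,N\}$, the value $f(n)$ is minimized at $n=N-\operatorname{rem}(N+1,d)$; that is, $f(N-\operatorname{rem}(N+1,d))\leq f(n)$ for every integer $n$ with $1\leq n\leq N$.
   Context: For a non-negative real $x$ and a positive real $y$, $\operatorname{rem}(x,y)=x-\lfloor x/y\rfloor\cdot y$, where $\lfloor\cdot\rfloor$ is the floor function. -}

module Defs where

open import Data.Nat using (ℕ; zero; suc; _∸_; NonZero)
open import Data.Nat.DivMod using (_%_)
open import Data.Integer using (+_)
open import Data.Rational using (ℚ; _/_; _+_; 0ℚ; 1ℚ)

rem : (x y : ℕ) → .{{NonZero y}} → ℕ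
rem x y = x % y

-- f(n) = 1 + (d - rem(n,d)) / n  (as a rational number), for d > 0.
-- Only meaningful for n ≥ 1; the value at n = 0 is a junk value (0) and is
-- never used by the statement (all arguments are ≥ 1).
-- Since rem(n,d) < d, the truncated subtraction d ∸ rem n d is the exact difference.
f : (d : ℕ) → .{{NonZero d}} → ℕ → ℚ
f d zero    = 0ℚ
f d (suc k) = 1ℚ + ((+ (d ∸ rem (suc k) d)) / suc k)

-- Write m = N ∸ rem(N+1, d). Then m + 1 is the largest multiple of d not
-- exceeding N + 1, so rem(m, d) = d - 1 and f(m) = 1 + 1/m; moreover every
-- n ≤ N satisfies n < m + d, and d ≤ m + 1. Cross-multiplied, f(m) ≤ f(n) reads
-- n ≤ (d - rem(n, d))·m. For n ≤ m this holds because d - rem(n, d) ≥ 1. For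
-- m < n < m + d, n lies in the window just past the multiple m + 1, so
-- rem(n, d) = n - (m + 1) ≤ d - 2; thus d - rem(n, d) ≥ 2, and n ≤ 2m as d ≤ m + 1.
module Submission where

open import Defs
open import Data.Nat using (ℕ; suc; _≤_; _<_; _∸_; _+_; _*_; s≤s; s≤s⁻¹; z≤n; _≤?_; NonZero; >-nonZero)
open import Data.Rational using (ℚ; 1ℚ) renaming (_≤_ to _≤ℚ_; _/_ to _/ℚ_)
open import Data.Nat.Properties
open import Data.Nat.DivMod
open import Data.Nat.Divisibility using (_∣_; divides; ∣⇒≤; n∣m⇒m%n≡0)
open import Data.Integer as ℤ using (ℤ; +≤+)
import Data.Integer.Properties as ℤ
import Data.Rational.Properties as ℚ
open import Data.Rational.Unnormalised using (mkℚᵘ; *≤*)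
import Data.Rational.Unnormalised.Properties as ℚᵘ
open import Relation.Binary.PropositionalEquality
open import Relation.Nullary using (yes; no)

/-cross-≤ : ∀ (i j : ℤ) b e → i ℤ.* ℤ.+ suc e ℤ.≤ j ℤ.* ℤ.+ suc b → i /ℚ suc b ≤ℚ j /ℚ suc e
/-cross-≤ i j b e le = ℚ.toℚᵘ-cancel-≤
  (ℚᵘ.≤-respˡ-≃ (ℚᵘ.≃-sym (ℚ.toℚᵘ-fromℚᵘ (mkℚᵘ i b)))
    (ℚᵘ.≤-respʳ-≃ (ℚᵘ.≃-sym (ℚ.toℚᵘ-fromℚᵘ (mkℚᵘ j e))) (*≤* le)))

f-≤ : ∀ d .{{_ : NonZero d}} {m n} → 1 ≤ m → 1 ≤ n →
      (d ∸ rem m d) * n ≤ (d ∸ rem n d) * m → f d m ≤ℚ f d n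
f-≤ d {suc m} {suc n} _ _ le = ℚ.+-monoʳ-≤ 1ℚ (/-cross-≤ (ℤ.+ (d ∸ rem (suc m) d)) (ℤ.+ (d ∸ rem (suc n) d)) m n
  (subst₂ ℤ._≤_ (ℤ.pos-* (d ∸ rem (suc m) d) (suc n)) (ℤ.pos-* (d ∸ rem (suc n) d) (suc m)) (+≤+ le)))

d∣1+m⇒d∸m%d≡1 : ∀ {d m} .{{_ : NonZero d}} → d ∣ suc m → d ∸ m % d ≡ 1
d∣1+m⇒d∸m%d≡1 {d@(suc _)} {m} d∣1+m = begin
  d ∸ m % d        ≡⟨ cong (d ∸_) (%-pred-≡0 (n∣m⇒m%n≡0 (suc m) d d∣1+m)) ⟩
  d ∸ (d ∸ 1)      ≡⟨ m∸[m∸n]≡n {d} {1} (s≤s z≤n) ⟩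
  1                ∎
  where open ≡-Reasoning

d∣1+[n∸[n+1]%d] : ∀ d .{{_ : NonZero d}} n → (n + 1) % d ≤ n → d ∣ suc (n ∸ (n + 1) % d)
d∣1+[n∸[n+1]%d] d n r≤n = divides ((n + 1) / d) (begin
  suc (n ∸ r)      ≡⟨ +-comm 1 (n ∸ r) ⟩
  (n ∸ r) + 1      ≡⟨ +-∸-comm 1 r≤n ⟨
  (n + 1) ∸ r      ≡⟨ cong (_∸ r) (m≡m%n+[m/n]*n (n + 1) d) ⟩
  (r + q * d) ∸ r  ≡⟨ m+n∸m≡n r (q * d) ⟩
  q * d            ∎)
  where
  open ≡-Reasoning
  r = (n + 1) % d
  q = (n + 1) / d

n<[n∸r]+d : ∀ {n r d} → r ≤ n → r < d → n < (n ∸ r) + d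
n<[n∸r]+d {n} {r} {d} r≤n r<d = subst (_< (n ∸ r) + d) (m∸n+n≡m r≤n) (+-monoʳ-< (n ∸ r) r<d)

1+m+k≤[d∸[1+m+k]%d]*m : ∀ {d} .{{_ : NonZero d}} m k → d ∣ suc m → suc m + k < m + d →
                        suc m + k ≤ (d ∸ (suc m + k) % d) * m
1+m+k≤[d∸[1+m+k]%d]*m {d} m k d∣1+m@(divides q 1+m≡qd) n<m+d = begin
  suc m + k              ≡⟨ +-suc m k ⟨
  m + suc k              ≤⟨ +-monoʳ-≤ m k<m ⟩
  m + m                  ≡⟨ cong (m +_) (+-identityʳ m) ⟨
  2 * m                  ≤⟨ *-monoˡ-≤ m 2≤d∸k ⟩
  (d ∸ k) * m            ≡⟨ cong (λ x → (d ∸ x) * m) [1+m+k]%d≡k ⟨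
  (d ∸ (suc m + k) % d) * m ∎
  where
  open ≤-Reasoning
  2+k≤d : 2 + k ≤ d
  2+k≤d = +-cancelˡ-≤ m _ _ (subst (_≤ m + d) (sym (trans (+-suc m (suc k)) (cong suc (+-suc m k)))) n<m+d)
  2≤d∸k : 2 ≤ d ∸ k
  2≤d∸k = subst (_≤ d ∸ k) (m+n∸n≡m 2 k) (∸-monoˡ-≤ k 2+k≤d)
  k<m : k < m
  k<m = s≤s⁻¹ (≤-trans 2+k≤d (∣⇒≤ d∣1+m))
  [1+m+k]%d≡k : (suc m + k) % d ≡ k
  [1+m+k]%d≡k = begin-equality
    (suc m + k) % d      ≡⟨ cong (_% d) (trans (+-comm (suc m) k) (cong (k +_) 1+m≡qd)) ⟩
    (k + q * d) % d      ≡⟨ [m+kn]%n≡m%n k q d ⟩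
    k % d                ≡⟨ m<n⇒m%n≡m (≤-trans (n≤1+n (suc k)) 2+k≤d) ⟩
    k                    ∎

n≤[d∸n%d]*m : ∀ {d} .{{_ : NonZero d}} m n → d ∣ suc m → n < m + d → n ≤ (d ∸ n % d) * m
n≤[d∸n%d]*m {d} m n d∣1+m n<m+d with n ≤? m
... | yes n≤m = ≤-trans n≤m (m≤n*m m (d ∸ n % d) {{>-nonZero (m<n⇒0<n∸m (m%n<n n d))}})
... | no n≰m  = subst (λ x → x ≤ (d ∸ x % d) * m) 1+m+k≡n
                  (1+m+k≤[d∸[1+m+k]%d]*m m k d∣1+m (subst (_< m + d) (sym 1+m+k≡n) n<m+d))
  where
  k = n ∸ suc m
  1+m+k≡n : suc m + k ≡ n
  1+m+k≡n = m+[n∸m]≡n (≰⇒> n≰m)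

lemma2 : (d N : ℕ) → .{{_ : NonZero d}} → d ≤ N →
         (n : ℕ) → 1 ≤ n → n ≤ N →
         f d (N ∸ rem (N + 1) d) ≤ℚ f d n
lemma2 d N d≤N n 1≤n n≤N = f-≤ d 1≤m 1≤n (begin
  (d ∸ m % d) * n   ≡⟨ cong (_* n) (d∣1+m⇒d∸m%d≡1 d∣1+m) ⟩
  1 * n             ≡⟨ *-identityˡ n ⟩
  n                 ≤⟨ n≤[d∸n%d]*m m n d∣1+m (≤-<-trans n≤N N<m+d) ⟩
  (d ∸ n % d) * m   ∎)
  where
  open ≤-Reasoning
  r = (N + 1) % d
  m = N ∸ r
  r<d : r < d
  r<d = m%n<n (N + 1) d
  r≤N : r ≤ N
  r≤N = ≤-trans (<⇒≤ r<d) d≤N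
  d∣1+m : d ∣ suc m
  d∣1+m = d∣1+[n∸[n+1]%d] d N r≤N
  N<m+d : N < m + d
  N<m+d = n<[n∸r]+d r≤N r<d
  1≤m : 1 ≤ m
  1≤m = +-cancelʳ-< d 0 m (≤-<-trans d≤N N<m+d)
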